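{- Let $k\ge 3$. Start with the empty graph on $k$ vertices and add the edges of $K_k$ one at a time in some order until the graph is complete. Then there exists a vertex $v$ such that at least $\frac{(k-1)(k-2)}{6}$ edges $w_iw_j$ (with $w_i,w_j \neq v$) were added after both of the edges $vw_i$ and $vw_j$ had been added. -}

module Defs where

open import Data.Nat using (ℕ; _<_; _<?_)
open import Data.Fin using (Fin) renaming (_<_ to _<ᶠ_; _<?_ to _<ᶠ?_)
open import Data.Fin.Properties using (_≟_)
open import Data.List using (List; length; filter; allFin; cartesianProduct)
open import Data.Product using (_×_; _,_; proj₁; proj₂)
open import Data.Sum using (_⊎_)
open import Relation.Binary.PropositionalEquality using (_≡_)
open import Relation.Nullary using (¬_; Dec)
open import Relation.Nullary.Decidable using (_×-dec_; ¬?)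

-- An edge ordering of K_k: each edge {i,j} (i ≠ j) gets an insertion time
-- t i j ∈ ℕ; t is symmetric and distinct edges get distinct times
-- (edges are added one at a time). Only the relative order of times matters.
record EdgeOrder (k : ℕ) : Set where
  field
    time : Fin k → Fin k → ℕ
    sym  : ∀ i j → time i j ≡ time j i
    inj  : ∀ i j i' j' → ¬ i ≡ j → ¬ i' ≡ j' → time i j ≡ time i' j' →
           (i ≡ i' × j ≡ j') ⊎ (i ≡ j' × j ≡ i')

pairs : (k : ℕ) → List (Fin k × Fin k)
pairs k = filter (λ p → proj₁ p <ᶠ? proj₂ p)
                 (cartesianProduct (allFin k) (allFin k))

good? : ∀ {k} → (t : Fin k → Fin k → ℕ) → (v : Fin k) → (p : Fin k × Fin k) → Dec _
good? t v (i , j) =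
  ¬? (i ≟ v) ×-dec ¬? (j ≟ v) ×-dec (t v i <? t i j) ×-dec (t v j <? t i j)

goodCount : ∀ {k} → EdgeOrder k → Fin k → ℕ
goodCount {k} o v = length (filter (good? (EdgeOrder.time o) v) (pairs k))

-- In every triangle {a, b, c} of K_k one of the three edges, say bc, is added
-- last, and then bc counts for the vertex a.  So the counts of all vertices add
-- up to at least the number C(k,3) of triangles, and some vertex reaches the
-- average C(k,3)/k = (k-1)(k-2)/6.  To stay in ℕ, triangles are counted as
-- ordered triples of distinct vertices, of which there are k(k-1)(k-2).
module Submission where

open import Defs
open import Data.Nat using (ℕ; zero; suc; _+_; _*_; _∸_; _≤_; _<_; z≤n; s≤s)
open import Data.Nat.Properties
  using (+-*-semiring; <-cmp; <-trans; <⇒≤; ≰⇒>; ≤-refl; ≤-reflexive; ≤-trans; _≤?_; +-mono-≤; *-monoʳ-≤;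
         *-cancelˡ-≤; +-identityʳ; +-assoc; *-assoc; *-comm; m≤n+o⇒m∸n≤o; module ≤-Reasoning)
open import Algebra.Properties.Semiring.Sum +-*-semiring
  using (sum; sum-syntax; ∑-distrib-+; ∑-comm; sum-cong-≗; sum-replicate-zero; *-distribˡ-sum; *-distribʳ-sum)
open import Data.Bool using (true; false; if_then_else_)
open import Data.Fin using (Fin; zero; suc) renaming (_<_ to _<ᶠ_; _<?_ to _<ᶠ?_)
open import Data.Fin.Properties using (_≟_) renaming (<-cmp to <ᶠ-cmp)
open import Data.List using (List; length; filter; allFin; tabulate; cartesianProduct; map; _∷_; []; _++_)
open import Data.List.Properties using (filter-++; length-++; map-tabulate)
open import Data.Product using (_×_; _,_; ∃; ∃-syntax; proj₁; proj₂)
open import Data.Sum using (_⊎_; inj₁; inj₂)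
open import Function using (_∘_)
open import Level using (Level)
open import Relation.Binary.Definitions using (tri<; tri≈; tri>)
open import Relation.Binary.PropositionalEquality
  using (_≡_; _≢_; _≗_; refl; sym; trans; cong; cong₂; subst; ≢-sym; module ≡-Reasoning)
open import Relation.Nullary using (Dec; yes; no; does; contradiction)
open import Relation.Nullary.Decidable using (¬?; _×-dec_)
open import Relation.Unary using (Pred; Decidable)
open import Relation.Unary.Properties using (_∩?_)

private
  variable
    ℓ ℓ′ ℓ″ : Level
    A : Set ℓ
    B : Set ℓ′
    P : Set ℓ
    Q : Set ℓ′
    m n : ℕ

𝟙 : Dec P → ℕ
𝟙 d = if does d then 1 else 0

𝟙-≤ : (d : Dec P) → (P → 1 ≤ n) → 𝟙 d ≤ n
𝟙-≤ (yes p) 1≤n = 1≤n p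
𝟙-≤ (no _)  _   = z≤n

𝟙-×-dec : (d : Dec P) (e : Dec Q) → 𝟙 (d ×-dec e) ≡ 𝟙 d * 𝟙 e
𝟙-×-dec (yes _) (yes _) = refl
𝟙-×-dec (yes _) (no _)  = refl
𝟙-×-dec (no _)  _       = refl

𝟙+𝟙-¬? : (d : Dec P) → 𝟙 d + 𝟙 (¬? d) ≡ 1
𝟙+𝟙-¬? (yes _) = refl
𝟙+𝟙-¬? (no _)  = refl

1≤𝟙+𝟙 : (d : Dec P) (e : Dec Q) → P ⊎ Q → 1 ≤ 𝟙 d + 𝟙 e
1≤𝟙+𝟙 (yes _) _       _        = s≤s z≤n
1≤𝟙+𝟙 (no _)  (yes _) _        = s≤s z≤n
1≤𝟙+𝟙 (no ¬p) (no _)  (inj₁ p) = contradiction p ¬p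
1≤𝟙+𝟙 (no _)  (no ¬q) (inj₂ q) = contradiction q ¬q

1≤𝟙+𝟙+𝟙 : {R : Set ℓ″} (d : Dec P) (e : Dec Q) (f : Dec R) → P ⊎ Q ⊎ R → 1 ≤ 𝟙 d + 𝟙 e + 𝟙 f
1≤𝟙+𝟙+𝟙 (yes _) _       _       _               = s≤s z≤n
1≤𝟙+𝟙+𝟙 (no _)  (yes _) _       _               = s≤s z≤n
1≤𝟙+𝟙+𝟙 (no _)  (no _)  (yes _) _               = s≤s z≤n
1≤𝟙+𝟙+𝟙 (no ¬p) (no _)  (no _)  (inj₁ p)        = contradiction p ¬p
1≤𝟙+𝟙+𝟙 (no _)  (no ¬q) (no _)  (inj₂ (inj₁ q)) = contradiction q ¬q
1≤𝟙+𝟙+𝟙 (no _)  (no _)  (no ¬r) (inj₂ (inj₂ r)) = contradiction r ¬r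

1≤𝟙+𝟙+𝟙-¬?×¬? : (d : Dec P) (e : Dec Q) → 1 ≤ 𝟙 d + 𝟙 e + 𝟙 (¬? d ×-dec ¬? e)
1≤𝟙+𝟙+𝟙-¬?×¬? (yes _) _       = s≤s z≤n
1≤𝟙+𝟙+𝟙-¬?×¬? (no _)  (yes _) = s≤s z≤n
1≤𝟙+𝟙+𝟙-¬?×¬? (no _)  (no _)  = s≤s z≤n

∑-const : ∀ c → ∑[ i < n ] c ≡ n * c
∑-const {zero}  c = refl
∑-const {suc n} c = cong (c +_) (∑-const {n} c)

∑-1 : ∑[ i < n ] 1 ≡ n
∑-1 {zero}  = refl
∑-1 {suc n} = cong suc (∑-1 {n})

∑-mono-≤ : {f g : Fin n → ℕ} → (∀ i → f i ≤ g i) → ∑[ i < n ] f i ≤ ∑[ i < n ] g i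
∑-mono-≤ {zero}  f≤g = z≤n
∑-mono-≤ {suc n} f≤g = +-mono-≤ (f≤g zero) (∑-mono-≤ (f≤g ∘ suc))

argmax : (f : Fin (suc n) → ℕ) → ∃[ v ] ∀ u → f u ≤ f v
argmax {zero}  f = zero , λ { zero → ≤-refl }
argmax {suc n} f with argmax (f ∘ suc)
... | v , f∘suc≤ with f zero ≤? f (suc v)
...   | yes f0≤ = suc v , λ { zero → f0≤ ; (suc u) → f∘suc≤ u }
...   | no f0≰  = zero , λ { zero → ≤-refl ; (suc u) → ≤-trans (f∘suc≤ u) (<⇒≤ (≰⇒> f0≰)) }

∑≤n*max : (f : Fin n → ℕ) (v : Fin n) → (∀ u → f u ≤ f v) → ∑[ u < n ] f u ≤ n * f v
∑≤n*max {n} f v max = ≤-trans (∑-mono-≤ max) (≤-reflexive (∑-const {n} (f v)))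

∑-𝟙-≟ : (a : Fin n) → ∑[ i < n ] 𝟙 (i ≟ a) ≡ 1
∑-𝟙-≟ {suc n} zero    = cong suc (sum-replicate-zero n)
∑-𝟙-≟ {suc n} (suc a) = ∑-𝟙-≟ a

∑-𝟙+∑-𝟙-¬? : {P : Pred (Fin n) ℓ} (P? : Decidable P) →
              ∑[ i < n ] 𝟙 (P? i) + ∑[ i < n ] 𝟙 (¬? (P? i)) ≡ n
∑-𝟙+∑-𝟙-¬? {n} P? = begin
  ∑[ i < n ] 𝟙 (P? i) + ∑[ i < n ] 𝟙 (¬? (P? i))  ≡⟨ sym (∑-distrib-+ (𝟙 ∘ P?) (𝟙 ∘ ¬? ∘ P?)) ⟩
  ∑[ i < n ] (𝟙 (P? i) + 𝟙 (¬? (P? i)))           ≡⟨ sum-cong-≗ {n} (𝟙+𝟙-¬? ∘ P?) ⟩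
  ∑[ i < n ] 1                                     ≡⟨ ∑-1 ⟩
  n                                                ∎
  where open ≡-Reasoning

∑-𝟙-≢ : (a : Fin n) → ∑[ i < n ] 𝟙 (¬? (i ≟ a)) ≡ n ∸ 1
∑-𝟙-≢ {n} a = begin
  others                             ≡⟨⟩
  1 + others ∸ 1                     ≡⟨ cong (λ s → s + others ∸ 1) (∑-𝟙-≟ a) ⟨
  ∑[ i < n ] 𝟙 (i ≟ a) + others ∸ 1  ≡⟨ cong (_∸ 1) (∑-𝟙+∑-𝟙-¬? (_≟ a)) ⟩
  n ∸ 1                              ∎
  where
  open ≡-Reasoning
  others : ℕ
  others = ∑[ i < n ] 𝟙 (¬? (i ≟ a))

n∸2≤∑-𝟙-≢₂ : (a b : Fin n) → n ∸ 2 ≤ ∑[ i < n ] 𝟙 (¬? (i ≟ a) ×-dec ¬? (i ≟ b))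
n∸2≤∑-𝟙-≢₂ {n} a b = m≤n+o⇒m∸n≤o n 2 (begin
  n                                         ≡⟨ ∑-1 ⟨
  ∑[ i < n ] 1                              ≤⟨ ∑-mono-≤ (λ i → 1≤𝟙+𝟙+𝟙-¬?×¬? (i ≟ a) (i ≟ b)) ⟩
  ∑[ i < n ] (is-a i + is-b i + neither i)  ≡⟨ ∑-distrib-+ (λ i → is-a i + is-b i) neither ⟩
  ∑[ i < n ] (is-a i + is-b i) + others     ≡⟨ cong (_+ others) (∑-distrib-+ is-a is-b) ⟩
  sum is-a + sum is-b + others              ≡⟨ cong₂ (λ x y → x + y + others) (∑-𝟙-≟ a) (∑-𝟙-≟ b) ⟩
  2 + others                                ∎)
  where
  open ≤-Reasoning
  is-a is-b neither : Fin n → ℕ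
  is-a i = 𝟙 (i ≟ a)
  is-b i = 𝟙 (i ≟ b)
  neither i = 𝟙 (¬? (i ≟ a) ×-dec ¬? (i ≟ b))
  others : ℕ
  others = sum neither

∑₃ : (Fin n → Fin n → Fin n → ℕ) → ℕ
∑₃ {n} f = ∑[ a < n ] ∑[ b < n ] ∑[ c < n ] f a b c

∑₃-mono-≤ : {f g : Fin n → Fin n → Fin n → ℕ} → (∀ a b c → f a b c ≤ g a b c) → ∑₃ f ≤ ∑₃ g
∑₃-mono-≤ f≤g = ∑-mono-≤ λ a → ∑-mono-≤ λ b → ∑-mono-≤ λ c → f≤g a b c

∑₃-distrib-+ : (f g : Fin n → Fin n → Fin n → ℕ) →
               ∑₃ (λ a b c → f a b c + g a b c) ≡ ∑₃ f + ∑₃ g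
∑₃-distrib-+ {n} f g = trans
  (sum-cong-≗ {n} λ a → trans
    (sum-cong-≗ {n} λ b → ∑-distrib-+ (f a b) (g a b))
    (∑-distrib-+ (λ b → ∑[ c < n ] f a b c) (λ b → ∑[ c < n ] g a b c)))
  (∑-distrib-+ (λ a → ∑[ b < n ] ∑[ c < n ] f a b c) (λ a → ∑[ b < n ] ∑[ c < n ] g a b c))

∑₃-rotate : (f : Fin n → Fin n → Fin n → ℕ) → ∑₃ (λ a b c → f b c a) ≡ ∑₃ f
∑₃-rotate {n} f = trans
  (∑-comm λ a b → ∑[ c < n ] f b c a)
  (sum-cong-≗ {n} λ b → ∑-comm λ a c → f b c a)

distinct? : (a b c : Fin n) → Dec (b ≢ a × c ≢ a × c ≢ b)
distinct? a b c = ¬? (b ≟ a) ×-dec ¬? (c ≟ a) ×-dec ¬? (c ≟ b)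

n*[n∸1]*[n∸2]≤∑₃-distinct : ∀ n → n * ((n ∸ 1) * (n ∸ 2)) ≤ ∑₃ {n} (λ a b c → 𝟙 (distinct? a b c))
n*[n∸1]*[n∸2]≤∑₃-distinct n = begin
  n * ((n ∸ 1) * (n ∸ 2))        ≡⟨ ∑-const {n} _ ⟨
  ∑[ a < n ] ((n ∸ 1) * (n ∸ 2)) ≤⟨ ∑-mono-≤ per-vertex ⟩
  ∑₃ {n} (λ a b c → 𝟙 (distinct? a b c)) ∎
  where
  open ≤-Reasoning
  per-vertex : (a : Fin n) → (n ∸ 1) * (n ∸ 2) ≤ ∑[ b < n ] ∑[ c < n ] 𝟙 (distinct? a b c)
  per-vertex a = begin
    (n ∸ 1) * (n ∸ 2)                       ≡⟨ cong (_* (n ∸ 2)) (∑-𝟙-≢ a) ⟨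
    (∑[ b < n ] ≠a b) * (n ∸ 2)             ≡⟨ *-distribʳ-sum (n ∸ 2) ≠a ⟩
    ∑[ b < n ] (≠a b * (n ∸ 2))             ≤⟨ ∑-mono-≤ (λ b → *-monoʳ-≤ (≠a b) (n∸2≤∑-𝟙-≢₂ a b)) ⟩
    ∑[ b < n ] (≠a b * ∑[ c < n ] ≠ab b c)  ≡⟨ sum-cong-≗ {n} (λ b → *-distribˡ-sum (≠a b) (≠ab b)) ⟩
    ∑[ b < n ] ∑[ c < n ] (≠a b * ≠ab b c)  ≡⟨ sum-cong-≗ {n} (λ b → sum-cong-≗ {n} (λ c → 𝟙-distinct b c)) ⟨
    ∑[ b < n ] ∑[ c < n ] 𝟙 (distinct? a b c) ∎
    where
    ≠a : Fin n → ℕ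
    ≠a b = 𝟙 (¬? (b ≟ a))
    ≠ab : Fin n → Fin n → ℕ
    ≠ab b c = 𝟙 (¬? (c ≟ a) ×-dec ¬? (c ≟ b))
    𝟙-distinct : ∀ b c → 𝟙 (distinct? a b c) ≡ ≠a b * ≠ab b c
    𝟙-distinct b c = 𝟙-×-dec (¬? (b ≟ a)) (¬? (c ≟ a) ×-dec ¬? (c ≟ b))

filter-filter : {P : Pred A ℓ} {Q : Pred A ℓ′} (P? : Decidable P) (Q? : Decidable Q) →
                filter Q? ∘ filter P? ≗ filter (P? ∩? Q?)
filter-filter P? Q? []       = refl
filter-filter P? Q? (x ∷ xs) with does (P? x)
... | false = filter-filter P? Q? xs
... | true with does (Q? x)
...   | false = filter-filter P? Q? xs
...   | true  = cong (x ∷_) (filter-filter P? Q? xs)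

length-filter-tabulate : {P : Pred A ℓ} (P? : Decidable P) (f : Fin n → A) →
                         length (filter P? (tabulate f)) ≡ ∑[ i < n ] 𝟙 (P? (f i))
length-filter-tabulate {n = zero}  P? f = refl
length-filter-tabulate {n = suc n} P? f with P? (f zero)
... | yes _ = cong suc (length-filter-tabulate P? (f ∘ suc))
... | no _  = length-filter-tabulate P? (f ∘ suc)

length-filter-cartesianProduct : {P : Pred (A × B) ℓ} (P? : Decidable P) (f : Fin n → A) (ys : List B) →
  length (filter P? (cartesianProduct (tabulate f) ys)) ≡ ∑[ i < n ] length (filter P? (map (f i ,_) ys))
length-filter-cartesianProduct {n = zero}  P? f ys = refl
length-filter-cartesianProduct {n = suc n} P? f ys = begin
  length (filter P? (map (f zero ,_) ys ++ rest))           ≡⟨ cong length (filter-++ P? (map (f zero ,_) ys) rest) ⟩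
  length (filter P? (map (f zero ,_) ys) ++ filter P? rest) ≡⟨ length-++ (filter P? (map (f zero ,_) ys)) ⟩
  length (filter P? (map (f zero ,_) ys)) + length (filter P? rest)
    ≡⟨ cong (length (filter P? (map (f zero ,_) ys)) +_) (length-filter-cartesianProduct P? (f ∘ suc) ys) ⟩
  ∑[ i < suc n ] length (filter P? (map (f i ,_) ys))      ∎
  where
  open ≡-Reasoning
  rest = cartesianProduct (tabulate (f ∘ suc)) ys

length-filter-allPairs : {P : Pred (Fin m × Fin n) ℓ} (P? : Decidable P) →
  length (filter P? (cartesianProduct (allFin m) (allFin n))) ≡ ∑[ i < m ] ∑[ j < n ] 𝟙 (P? (i , j))
length-filter-allPairs {m} {n} P? = trans
  (length-filter-cartesianProduct P? (λ i → i) (allFin n))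
  (sum-cong-≗ {m} λ i → trans
    (cong (length ∘ filter P?) (map-tabulate (λ j → j) (i ,_)))
    (length-filter-tabulate P? (i ,_)))

maximum-of-three-distinct : ∀ {x y z} → x ≢ y → y ≢ z → z ≢ x →
  (y < x × z < x) ⊎ (x < y × z < y) ⊎ (x < z × y < z)
maximum-of-three-distinct {x} {y} {z} x≢y y≢z z≢x with <-cmp x y
... | tri≈ _ x≡y _ = contradiction x≡y x≢y
... | tri< x<y _ _ with <-cmp y z
...   | tri< y<z _ _ = inj₂ (inj₂ (<-trans x<y y<z , y<z))
...   | tri≈ _ y≡z _ = contradiction y≡z y≢z
...   | tri> _ _ z<y = inj₂ (inj₁ (x<y , z<y))
maximum-of-three-distinct {x} {y} {z} x≢y y≢z z≢x | tri> _ _ y<x with <-cmp x z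
...   | tri< x<z _ _ = inj₂ (inj₂ (x<z , <-trans y<x x<z))
...   | tri≈ _ x≡z _ = contradiction (sym x≡z) z≢x
...   | tri> _ _ z<x = inj₁ (y<x , z<x)

module _ {k : ℕ} (o : EdgeOrder k) where
  open EdgeOrder o renaming (time to t; sym to t-sym)

  Good : Fin k → Fin k → Fin k → Set
  Good v i j = i ≢ v × j ≢ v × t v i < t i j × t v j < t i j

  Good-sym : ∀ {v i j} → Good v i j → Good v j i
  Good-sym {v} {i} {j} (i≢v , j≢v , tvi<tij , tvj<tij) =
    j≢v , i≢v , subst (t v j <_) (t-sym i j) tvj<tij , subst (t v i <_) (t-sym i j) tvi<tij

  Closes : Fin k → Fin k → Fin k → Set
  Closes v i j = i ≢ j × Good v i j

  closes? : (v i j : Fin k) → Dec (Closes v i j)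
  closes? v i j = ¬? (i ≟ j) ×-dec good? t v (i , j)

  adjacent-edges-differ : ∀ {a b c} → a ≢ b → b ≢ c → a ≢ c → t a b ≢ t b c
  adjacent-edges-differ a≢b b≢c a≢c tab≡tbc with inj _ _ _ _ a≢b b≢c tab≡tbc
  ... | inj₁ (a≡b , _) = a≢b a≡b
  ... | inj₂ (a≡c , _) = a≢c a≡c

  some-edge-closes : ∀ {a b c} → a ≢ b → b ≢ c → a ≢ c → Closes a b c ⊎ Closes b c a ⊎ Closes c a b
  some-edge-closes {a} {b} {c} a≢b b≢c a≢c
    with maximum-of-three-distinct (adjacent-edges-differ a≢b b≢c a≢c)
                                   (adjacent-edges-differ b≢c (≢-sym a≢c) (≢-sym a≢b))
                                   (adjacent-edges-differ (≢-sym a≢c) a≢b (≢-sym b≢c))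
  ... | inj₁ (tbc<tab , tca<tab) =
    inj₂ (inj₂ (a≢b , a≢c , b≢c , tca<tab , subst (_< t a b) (t-sym b c) tbc<tab))
  ... | inj₂ (inj₁ (tab<tbc , tca<tbc)) =
    inj₁ (b≢c , ≢-sym a≢b , ≢-sym a≢c , tab<tbc , subst (_< t b c) (t-sym c a) tca<tbc)
  ... | inj₂ (inj₂ (tab<tca , tbc<tca)) =
    inj₂ (inj₁ (≢-sym a≢c , ≢-sym b≢c , a≢b , tbc<tca , subst (_< t c a) (t-sym a b) tab<tca))

  GoodPair : Fin k → Fin k → Fin k → Set
  GoodPair v i j = i <ᶠ j × Good v i j

  goodPair? : (v i j : Fin k) → Dec (GoodPair v i j)
  goodPair? v i j = (i <ᶠ? j) ×-dec good? t v (i , j)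

  goodCount≡∑∑goodPair : ∀ v → goodCount o v ≡ ∑[ i < k ] ∑[ j < k ] 𝟙 (goodPair? v i j)
  goodCount≡∑∑goodPair v = trans
    (cong length (filter-filter ordered? (good? t v) (cartesianProduct (allFin k) (allFin k))))
    (length-filter-allPairs (ordered? ∩? good? t v))
    where
    ordered? : (p : Fin k × Fin k) → Dec (proj₁ p <ᶠ proj₂ p)
    ordered? (i , j) = i <ᶠ? j

  𝟙-closes≤𝟙-goodPair+𝟙-goodPair : ∀ v i j → 𝟙 (closes? v i j) ≤ 𝟙 (goodPair? v i j) + 𝟙 (goodPair? v j i)
  𝟙-closes≤𝟙-goodPair+𝟙-goodPair v i j = 𝟙-≤ (closes? v i j) λ closes →
    1≤𝟙+𝟙 (goodPair? v i j) (goodPair? v j i) (goodPair-either-way closes)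
    where
    goodPair-either-way : Closes v i j → GoodPair v i j ⊎ GoodPair v j i
    goodPair-either-way (i≢j , good) with <ᶠ-cmp i j
    ... | tri< i<j _ _ = inj₁ (i<j , good)
    ... | tri≈ _ i≡j _ = contradiction i≡j i≢j
    ... | tri> _ _ j<i = inj₂ (j<i , Good-sym good)

  ∑∑-closes≤2*goodCount : ∀ v → ∑[ i < k ] ∑[ j < k ] 𝟙 (closes? v i j) ≤ 2 * goodCount o v
  ∑∑-closes≤2*goodCount v = begin
    ∑[ i < k ] ∑[ j < k ] 𝟙 (closes? v i j)
      ≤⟨ ∑-mono-≤ (λ i → ∑-mono-≤ (𝟙-closes≤𝟙-goodPair+𝟙-goodPair v i)) ⟩
    ∑[ i < k ] ∑[ j < k ] (G i j + G j i)
      ≡⟨ sum-cong-≗ {k} (λ i → ∑-distrib-+ (G i) (λ j → G j i)) ⟩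
    ∑[ i < k ] (∑[ j < k ] G i j + ∑[ j < k ] G j i)
      ≡⟨ ∑-distrib-+ (λ i → ∑[ j < k ] G i j) (λ i → ∑[ j < k ] G j i) ⟩
    ∑∑G + ∑[ i < k ] ∑[ j < k ] G j i
      ≡⟨ cong (∑∑G +_) (∑-comm (λ i j → G j i)) ⟩
    ∑∑G + ∑∑G                   ≡⟨ cong (λ g → g + g) (goodCount≡∑∑goodPair v) ⟨
    goodCount o v + goodCount o v  ≡⟨ cong (goodCount o v +_) (+-identityʳ (goodCount o v)) ⟨
    2 * goodCount o v ∎
    where
    open ≤-Reasoning
    G : Fin k → Fin k → ℕ
    G i j = 𝟙 (goodPair? v i j)
    ∑∑G : ℕ
    ∑∑G = ∑[ i < k ] ∑[ j < k ] G i j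

  k*[k∸1]*[k∸2]≤6*∑goodCount : k * ((k ∸ 1) * (k ∸ 2)) ≤ 6 * ∑[ v < k ] goodCount o v
  k*[k∸1]*[k∸2]≤6*∑goodCount = begin
    k * ((k ∸ 1) * (k ∸ 2))                             ≤⟨ n*[n∸1]*[n∸2]≤∑₃-distinct k ⟩
    ∑₃ {k} (λ a b c → 𝟙 (distinct? a b c))              ≤⟨ ∑₃-mono-≤ 𝟙-distinct≤ ⟩
    ∑₃ (λ a b c → C a b c + C b c a + C c a b)          ≡⟨ ∑₃-distrib-+ (λ a b c → C a b c + C b c a) (λ a b c → C c a b) ⟩
    ∑₃ (λ a b c → C a b c + C b c a) + ∑₃ (λ a b c → C c a b)
      ≡⟨ cong₂ _+_ (∑₃-distrib-+ C (λ a b c → C b c a)) (trans (∑₃-rotate (λ a b c → C b c a)) (∑₃-rotate C)) ⟩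
    ∑₃ C + ∑₃ (λ a b c → C b c a) + ∑₃ C                ≡⟨ cong (λ s → ∑₃ C + s + ∑₃ C) (∑₃-rotate C) ⟩
    ∑₃ C + ∑₃ C + ∑₃ C                                  ≡⟨ +-assoc (∑₃ C) (∑₃ C) (∑₃ C) ⟩
    ∑₃ C + (∑₃ C + ∑₃ C)                                ≡⟨ cong (λ s → ∑₃ C + (∑₃ C + s)) (+-identityʳ (∑₃ C)) ⟨
    3 * ∑₃ C                                            ≤⟨ *-monoʳ-≤ 3 (∑-mono-≤ ∑∑-closes≤2*goodCount) ⟩
    3 * ∑[ v < k ] (2 * goodCount o v)                  ≡⟨ cong (3 *_) (*-distribˡ-sum 2 (goodCount o)) ⟨
    3 * (2 * ∑[ v < k ] goodCount o v)                  ≡⟨ *-assoc 3 2 (∑[ v < k ] goodCount o v) ⟨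
    6 * ∑[ v < k ] goodCount o v                        ∎
    where
    open ≤-Reasoning
    C : Fin k → Fin k → Fin k → ℕ
    C v i j = 𝟙 (closes? v i j)
    𝟙-distinct≤ : ∀ a b c → 𝟙 (distinct? a b c) ≤ C a b c + C b c a + C c a b
    𝟙-distinct≤ a b c = 𝟙-≤ (distinct? a b c) λ (b≢a , c≢a , c≢b) →
      1≤𝟙+𝟙+𝟙 (closes? a b c) (closes? b c a) (closes? c a b)
              (some-edge-closes (≢-sym b≢a) (≢-sym c≢b) (≢-sym c≢a))

lemma1 : (k : ℕ) → 3 ≤ k → (o : EdgeOrder k) →
    ∃ λ (v : Fin k) → (k ∸ 1) * (k ∸ 2) ≤ 6 * goodCount o v
-- The hypothesis 3 ≤ k only serves to exclude k = 0, where there is no vertex.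
lemma1 (suc k) _ o with argmax (goodCount o)
... | v , maximal = v , *-cancelˡ-≤ (suc k) (begin
  suc k * (k * (k ∸ 1))          ≤⟨ k*[k∸1]*[k∸2]≤6*∑goodCount o ⟩
  6 * ∑[ u < suc k ] goodCount o u ≤⟨ *-monoʳ-≤ 6 (∑≤n*max (goodCount o) v maximal) ⟩
  6 * (suc k * goodCount o v)    ≡⟨ *-assoc 6 (suc k) (goodCount o v) ⟨
  6 * suc k * goodCount o v      ≡⟨ cong (_* goodCount o v) (*-comm 6 (suc k)) ⟩
  suc k * 6 * goodCount o v      ≡⟨ *-assoc (suc k) 6 (goodCount o v) ⟩
  suc k * (6 * goodCount o v)    ∎)
  where open ≤-Reasoning
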